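{- Let $k\ge 0$ be an integer and $n=48k+46$. Define $c_2(r)\in\mathbb{Z}_n$ for $0\le r\le n-1$ as follows (all arithmetic modulo $n$): for $0\le i\le 12k+11$, $c_2(2i)=6k+5+i(12k+12)$; for $0\le i\le 12k+10$, $c_2(2i+1)=12k+11+i(12k+12)$ (this defines $c_2(r)$ for $0\le r\le 24k+22$); and for $0\le r\le 24k+22$, $c_2(n-1-r)=n-1-c_2(r)$. Let ${\cal L}_2=[l_2(r,j)]$ be the $n\times n$ array with $l_2(r,j)\equiv c_2(r)+j \pmod n$ for $0\le r,j\le n-1$. Then ${\cal L}_2$ is a Latin square of order $n$.
   Context: A Latin square of order $n$ is an $n\times n$ array in which each row and each column contains each of the symbols $0,1,\dots,n-1$ exactly once. -}

module Defs where

open import Data.Nat using (ℕ; zero; suc; _+_; _*_; _∸_; _≤ᵇ_)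
open import Data.Nat.DivMod using (_%_; _/_)
open import Data.Bool using (if_then_else_)
open import Data.Fin using (Fin; toℕ; fromℕ<)
open import Data.Nat.DivMod using (m%n<n)
open import Function.Definitions using (Bijective)
open import Data.Product using (_×_)
open import Relation.Binary.PropositionalEquality using (_≡_)

order : ℕ → ℕ
order k = suc (48 * k + 45)

Array : ℕ → Set
Array n = Fin n → Fin n → Fin n

IsLatinSquare : (n : ℕ) → Array n → Set
IsLatinSquare n L =
  ((r : Fin n) → Bijective _≡_ _≡_ (λ j → L r j)) ×
  ((j : Fin n) → Bijective _≡_ _≡_ (λ r → L r j))

c2-low : ℕ → ℕ → ℕ
c2-low k r =
  if (r % 2) ≤ᵇ 0
  then (6 * k + 5 + (r / 2) * (12 * k + 12)) % order k
  else (12 * k + 11 + (r / 2) * (12 * k + 12)) % order k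

c2 : ℕ → ℕ → ℕ
c2 k r =
  if r ≤ᵇ (24 * k + 22)
  then c2-low k r
  else (order k ∸ 1) ∸ c2-low k ((order k ∸ 1) ∸ r)

L2 : (k : ℕ) → Array (order k)
L2 k r j = fromℕ< (m%n<n (c2 k (toℕ r) + toℕ j) (order k))

-- On the first half of the rows c₂ is the affine map r ↦ 6k+5 + r(6k+6) modulo n = 48k+46.
-- Since 6k+6 = 2(3k+3) and 8(3k+3) = (24k+23) + 1, the step 3k+3 is invertible modulo
-- n/2 = 24k+23, so these 24k+23 rows take every odd value exactly once; the reflection
-- c₂(n-1-r) = n-1-c₂(r) then covers the even values. Hence c₂ is a permutation of ℤ_n, and
-- both the rows j ↦ c₂(r)+j and the columns r ↦ c₂(r)+j of L₂ are bijections.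
module Submission where

open import Defs
open import Data.Nat using (ℕ; zero; suc; _+_; _*_; _∸_; _≤_; _<_; _≤ᵇ_; NonZero; z≤n; s≤s; s≤s⁻¹)
open import Data.Nat.Properties
open import Data.Nat.DivMod
open import Data.Nat.Tactic.RingSolver using (solve-∀)
open import Data.Fin using (Fin; toℕ; fromℕ<; punchOut)
open import Data.Fin.Properties using (toℕ<n; toℕ-fromℕ<; toℕ-injective; any?; punchOut-injective; injective⇒≤) renaming (_≟_ to _≟ᶠ_)
open import Data.Product using (∃; _×_; _,_; proj₁; proj₂)
open import Data.Sum using (_⊎_; inj₁; inj₂)
open import Data.Bool using (true; false; T)
open import Relation.Nullary using (yes; no; contradiction)
open import Relation.Binary.PropositionalEquality
open import Function.Definitions using (Injective; StrictlySurjective; Bijective)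
open import Function.Consequences.Propositional using (strictlySurjective⇒surjective)

open ≡-Reasoning

injective⇒strictlySurjective : ∀ {n} {f : Fin n → Fin n} →
  Injective _≡_ _≡_ f → StrictlySurjective _≡_ f
injective⇒strictlySurjective {suc n} {f} f-injective y with any? (λ x → f x ≟ᶠ y)
... | yes hit  = hit
... | no  miss = contradiction (injective⇒≤ punchOut∘f-injective) 1+n≰n
  where
  y≢f : ∀ x → y ≢ f x
  y≢f x y≡fx = miss (x , sym y≡fx)

  punchOut∘f-injective : Injective _≡_ _≡_ (λ x → punchOut (y≢f x))
  punchOut∘f-injective eq = f-injective (punchOut-injective (y≢f _) (y≢f _) eq)

strictlySurjective⇒bijective : ∀ {n} {f : Fin n → Fin n} →
  StrictlySurjective _≡_ f → Bijective _≡_ _≡_ f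
strictlySurjective⇒bijective {n} {f} f-surjective =
  f-injective , strictlySurjective⇒surjective f-surjective
  where
  section : Fin n → Fin n
  section y = proj₁ (f-surjective y)

  f∘section : ∀ y → f (section y) ≡ y
  f∘section y = proj₂ (f-surjective y)

  section-injective : Injective _≡_ _≡_ section
  section-injective {a} {b} eq = trans (sym (f∘section a)) (trans (cong f eq) (f∘section b))

  f-injective : Injective _≡_ _≡_ f
  f-injective {x} {y} fx≡fy
    with injective⇒strictlySurjective section-injective x
       | injective⇒strictlySurjective section-injective y
  ... | a , refl | b , refl = cong section (trans (sym (f∘section a)) (trans fx≡fy (f∘section b)))

[m+n%d*o]%d≡[m+n*o]%d : ∀ m n o d .{{_ : NonZero d}} → (m + n % d * o) % d ≡ (m + n * o) % d
[m+n%d*o]%d≡[m+n*o]%d m n o d = begin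
  (m + n % d * o) % d                  ≡⟨ [m+kn]%n≡m%n (m + n % d * o) (n / d * o) d ⟨
  (m + n % d * o + n / d * o * d) % d  ≡⟨ %-congˡ (regroup m (n % d) (n / d) o d) ⟩
  (m + (n % d + n / d * d) * o) % d    ≡⟨ cong (λ t → (m + t * o) % d) (m≡m%n+[m/n]*n n d) ⟨
  (m + n * o) % d                      ∎
  where
  regroup : ∀ m r q o d → m + r * o + q * o * d ≡ m + (r + q * d) * o
  regroup = solve-∀

[m+n%d]%d≡[m+n]%d : ∀ m n d .{{_ : NonZero d}} → (m + n % d) % d ≡ (m + n) % d
[m+n%d]%d≡[m+n]%d m n d = begin
  (m + n % d) % d      ≡⟨ cong (λ t → (m + t) % d) (*-identityʳ (n % d)) ⟨
  (m + n % d * 1) % d  ≡⟨ [m+n%d*o]%d≡[m+n*o]%d m n 1 d ⟩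
  (m + n * 1) % d      ≡⟨ cong (λ t → (m + t) % d) (*-identityʳ n) ⟩
  (m + n) % d          ∎

[m*2+1]%[n*2]≡m%n*2+1 : ∀ m n → (m * 2 + 1) % (suc n * 2) ≡ m % suc n * 2 + 1
[m*2+1]%[n*2]≡m%n*2+1 m n = begin
  (m * 2 + 1) % (suc n * 2)        ≡⟨ [m*n+o]%[p*n]≡[m*n]%[p*n]+o m (suc n) (s≤s (s≤s z≤n)) ⟩
  m * 2 % (suc n * 2) + 1          ≡⟨ cong (_+ 1) (m%n*o≡m*o%[n*o] m (suc n) 2) ⟨
  m % suc n * 2 + 1                ∎

+%-surjective : ∀ n .{{_ : NonZero n}} {c} → c ≤ n → ∀ {v} → v < n →
  ∃ λ x → x < n × (c + x) % n ≡ v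
+%-surjective n {c} c≤n {v} v<n = (v + (n ∸ c)) % n , m%n<n _ n , (begin
  (c + (v + (n ∸ c)) % n) % n  ≡⟨ [m+n%d]%d≡[m+n]%d c (v + (n ∸ c)) n ⟩
  (c + (v + (n ∸ c))) % n      ≡⟨ %-congˡ (swap c v (n ∸ c)) ⟩
  (v + (c + (n ∸ c))) % n      ≡⟨ cong (λ t → (v + t) % n) (m+[n∸m]≡n c≤n) ⟩
  (v + n) % n                  ≡⟨ [m+n]%n≡m%n v n ⟩
  v % n                        ≡⟨ m<n⇒m%n≡m v<n ⟩
  v                            ∎)
  where
  swap : ∀ a b c → a + (b + c) ≡ b + (a + c)
  swap = solve-∀

[n*2+1]∸[[n∸m]*2+1]≡m*2 : ∀ {m n} → m ≤ n → (n * 2 + 1) ∸ ((n ∸ m) * 2 + 1) ≡ m * 2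
[n*2+1]∸[[n∸m]*2+1]≡m*2 {m} {n} m≤n = begin
  (n * 2 + 1) ∸ (d * 2 + 1)              ≡⟨ cong (λ t → (t * 2 + 1) ∸ (d * 2 + 1)) (m+[n∸m]≡n m≤n) ⟨
  ((m + d) * 2 + 1) ∸ (d * 2 + 1)        ≡⟨ cong (_∸ (d * 2 + 1)) (split m d) ⟩
  (m * 2 + (d * 2 + 1)) ∸ (d * 2 + 1)    ≡⟨ m+n∸n≡m (m * 2) (d * 2 + 1) ⟩
  m * 2                                  ∎
  where
  d = n ∸ m
  split : ∀ m d → (m + d) * 2 + 1 ≡ m * 2 + (d * 2 + 1)
  split = solve-∀

even-or-odd : ∀ v → ∃ λ w → v ≡ w * 2 ⊎ v ≡ w * 2 + 1
even-or-odd zero = zero , inj₁ refl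
even-or-odd (suc zero) = zero , inj₂ refl
even-or-odd (suc (suc v)) with even-or-odd v
... | w , inj₁ refl = suc w , inj₁ refl
... | w , inj₂ refl = suc w , inj₂ refl

mod-map-bijective : ∀ n .{{_ : NonZero n}} (g : ℕ → ℕ) →
  (∀ {v} → v < n → ∃ λ x → x < n × g x % n ≡ v) →
  Bijective _≡_ _≡_ (λ (x : Fin n) → fromℕ< (m%n<n (g (toℕ x)) n))
mod-map-bijective n g hits = strictlySurjective⇒bijective λ y →
  let x , x<n , gx≡y = hits (toℕ<n y) in
  fromℕ< x<n , toℕ-injective (begin
    toℕ (fromℕ< (m%n<n (g (toℕ (fromℕ< x<n))) n))  ≡⟨ toℕ-fromℕ< (m%n<n (g (toℕ (fromℕ< x<n))) n) ⟩
    g (toℕ (fromℕ< x<n)) % n                       ≡⟨ cong (λ t → g t % n) (toℕ-fromℕ< x<n) ⟩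
    g x % n                                         ≡⟨ gx≡y ⟩
    toℕ y                                           ∎)

halfOrder : ℕ → ℕ
halfOrder k = suc (24 * k + 22)

order≡halfOrder*2 : ∀ k → order k ≡ halfOrder k * 2
order≡halfOrder*2 k = doubled k
  where
  doubled : ∀ k → suc (48 * k + 45) ≡ suc (24 * k + 22) * 2
  doubled = solve-∀

c2-low≡affine : ∀ k r → c2-low k r ≡ (6 * k + 5 + r * (6 * k + 6)) % order k
c2-low≡affine k r with r % 2 | r / 2 | m%n<n r 2 | m≡m%n+[m/n]*n r 2
... | 0 | i | _ | refl = %-congˡ (even-row k i)
  where
  even-row : ∀ k i → 6 * k + 5 + i * (12 * k + 12) ≡ 6 * k + 5 + i * 2 * (6 * k + 6)
  even-row = solve-∀
... | 1 | i | _ | refl = %-congˡ (odd-row k i)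
  where
  odd-row : ∀ k i → 12 * k + 11 + i * (12 * k + 12) ≡ 6 * k + 5 + (1 + i * 2) * (6 * k + 6)
  odd-row = solve-∀
... | suc (suc _) | _ | s≤s (s≤s ()) | _

c2-low≡odd : ∀ k r → c2-low k r ≡ (3 * k + 2 + r * (3 * k + 3)) % halfOrder k * 2 + 1
c2-low≡odd k r = begin
  c2-low k r                                                ≡⟨ c2-low≡affine k r ⟩
  (6 * k + 5 + r * (6 * k + 6)) % order k                   ≡⟨ %-congʳ {o = 6 * k + 5 + r * (6 * k + 6)} (order≡halfOrder*2 k) ⟩
  (6 * k + 5 + r * (6 * k + 6)) % (halfOrder k * 2)         ≡⟨ %-congˡ (halve k r) ⟩
  ((3 * k + 2 + r * (3 * k + 3)) * 2 + 1) % (halfOrder k * 2)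
    ≡⟨ [m*2+1]%[n*2]≡m%n*2+1 (3 * k + 2 + r * (3 * k + 3)) (24 * k + 22) ⟩
  (3 * k + 2 + r * (3 * k + 3)) % halfOrder k * 2 + 1       ∎
  where
  halve : ∀ k r → 6 * k + 5 + r * (6 * k + 6) ≡ (3 * k + 2 + r * (3 * k + 3)) * 2 + 1
  halve = solve-∀

-- 8(3k+3) ≡ 1 and 21k+21 ≡ -(3k+2) modulo 24k+23.
c2-low⁻¹ : ℕ → ℕ → ℕ
c2-low⁻¹ k w = 8 * (w + 21 * k + 21) % halfOrder k

c2-low∘c2-low⁻¹ : ∀ k {w} → w < halfOrder k → c2-low k (c2-low⁻¹ k w) ≡ w * 2 + 1
c2-low∘c2-low⁻¹ k {w} w<h = begin
  c2-low k (c2-low⁻¹ k w)                                    ≡⟨ c2-low≡odd k (c2-low⁻¹ k w) ⟩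
  (3 * k + 2 + c2-low⁻¹ k w * (3 * k + 3)) % h * 2 + 1     ≡⟨ cong (λ t → t * 2 + 1) inverse ⟩
  w * 2 + 1                                                  ∎
  where
  h = halfOrder k
  b = 8 * (w + 21 * k + 21)

  unfold : ∀ k w → 3 * k + 2 + 8 * (w + 21 * k + 21) * (3 * k + 3)
                 ≡ w + (w + 21 * k + 22) * suc (24 * k + 22)
  unfold = solve-∀

  inverse : (3 * k + 2 + b % h * (3 * k + 3)) % h ≡ w
  inverse = begin
    (3 * k + 2 + b % h * (3 * k + 3)) % h   ≡⟨ [m+n%d*o]%d≡[m+n*o]%d (3 * k + 2) b (3 * k + 3) h ⟩
    (3 * k + 2 + b * (3 * k + 3)) % h       ≡⟨ %-congˡ (unfold k w) ⟩
    (w + (w + 21 * k + 22) * h) % h         ≡⟨ [m+kn]%n≡m%n w (w + 21 * k + 22) h ⟩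
    w % h                                   ≡⟨ m<n⇒m%n≡m w<h ⟩
    w                                       ∎

c2-lower : ∀ k {r} → r ≤ 24 * k + 22 → c2 k r ≡ c2-low k r
c2-lower k {r} r≤ with r ≤ᵇ (24 * k + 22) | ≤⇒≤ᵇ r≤
... | true | _ = refl

c2-upper : ∀ k {r} → 24 * k + 22 < r → c2 k r ≡ (48 * k + 45) ∸ c2-low k ((48 * k + 45) ∸ r)
c2-upper k {r} r> with r ≤ᵇ (24 * k + 22) in lower
... | false = refl
... | true  = contradiction (≤ᵇ⇒≤ r (24 * k + 22) (subst T (sym lower) _)) (<⇒≱ r>)

c2<order : ∀ k r → c2 k r < order k
c2<order k r with r ≤ᵇ (24 * k + 22)
... | true  = subst (_< order k) (sym (c2-low≡affine k r)) (m%n<n (6 * k + 5 + r * (6 * k + 6)) (order k))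
... | false = s≤s (m∸n≤m (48 * k + 45) (c2-low k ((48 * k + 45) ∸ r)))

c2-hits-odd : ∀ k {w} → w < halfOrder k → ∃ λ r → r < order k × c2 k r ≡ w * 2 + 1
c2-hits-odd k {w} w<h =
  r , <-≤-trans r<h halfOrder≤order , trans (c2-lower k (s≤s⁻¹ r<h)) (c2-low∘c2-low⁻¹ k w<h)
  where
  r = c2-low⁻¹ k w
  r<h : r < halfOrder k
  r<h = m%n<n (8 * (w + 21 * k + 21)) (halfOrder k)
  halfOrder≤order : halfOrder k ≤ order k
  halfOrder≤order = ≤-trans (m≤m*n (halfOrder k) 2) (≤-reflexive (sym (order≡halfOrder*2 k)))

c2-hits-even : ∀ k {w} → w < halfOrder k → ∃ λ r → r < order k × c2 k r ≡ w * 2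
c2-hits-even k {w} w<h = r , s≤s (m∸n≤m (48 * k + 45) r′) , (begin
  c2 k r                                                  ≡⟨ c2-upper k upper ⟩
  (48 * k + 45) ∸ c2-low k ((48 * k + 45) ∸ r)            ≡⟨ cong (λ t → (48 * k + 45) ∸ c2-low k t) (m∸[m∸n]≡n r′≤top) ⟩
  (48 * k + 45) ∸ c2-low k r′                             ≡⟨ cong ((48 * k + 45) ∸_) (c2-low∘c2-low⁻¹ k w′<h) ⟩
  (48 * k + 45) ∸ (w′ * 2 + 1)                            ≡⟨ cong (_∸ (w′ * 2 + 1)) (top≡ k) ⟩
  ((24 * k + 22) * 2 + 1) ∸ (w′ * 2 + 1)                  ≡⟨ [n*2+1]∸[[n∸m]*2+1]≡m*2 (s≤s⁻¹ w<h) ⟩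
  w * 2                                                   ∎)
  where
  w′ = 24 * k + 22 ∸ w
  r′ = c2-low⁻¹ k w′
  r = (48 * k + 45) ∸ r′

  top≡ : ∀ k → 48 * k + 45 ≡ (24 * k + 22) * 2 + 1
  top≡ = solve-∀

  halves : ∀ k → 48 * k + 45 ≡ (24 * k + 22) + suc (24 * k + 22)
  halves = solve-∀

  w′<h : w′ < halfOrder k
  w′<h = s≤s (m∸n≤m (24 * k + 22) w)

  r′≤ : r′ ≤ 24 * k + 22
  r′≤ = s≤s⁻¹ (m%n<n (8 * (w′ + 21 * k + 21)) (halfOrder k))

  r′≤top : r′ ≤ 48 * k + 45
  r′≤top = ≤-trans r′≤ (≤-trans (m≤m+n _ _) (≤-reflexive (sym (halves k))))

  upper : 24 * k + 22 < r
  upper = ≤-trans (≤-reflexive (sym top∸lower)) (∸-monoʳ-≤ (48 * k + 45) r′≤)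
    where
    top∸lower : (48 * k + 45) ∸ (24 * k + 22) ≡ suc (24 * k + 22)
    top∸lower = trans (cong (_∸ (24 * k + 22)) (halves k)) (m+n∸m≡n (24 * k + 22) _)

<order⇒<halfOrder : ∀ k {w v} → w * 2 ≤ v → v < order k → w < halfOrder k
<order⇒<halfOrder k {w} {v} w*2≤v v<n =
  *-cancelʳ-< 2 w (halfOrder k) (≤-<-trans w*2≤v (subst (v <_) (order≡halfOrder*2 k) v<n))

c2-surjective : ∀ k {v} → v < order k → ∃ λ r → r < order k × c2 k r ≡ v
c2-surjective k {v} v<n with even-or-odd v
... | w , inj₁ refl = c2-hits-even k {w} (<order⇒<halfOrder k ≤-refl v<n)
... | w , inj₂ refl = c2-hits-odd k {w} (<order⇒<halfOrder k (m≤m+n (w * 2) 1) v<n)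

lemma11 : (k : ℕ) → IsLatinSquare (order k) (L2 k)
lemma11 k = rows , columns
  where
  n = order k

  rows : ∀ r → Bijective _≡_ _≡_ (λ j → L2 k r j)
  rows r = mod-map-bijective n (c2 k (toℕ r) +_) (+%-surjective n (<⇒≤ (c2<order k (toℕ r))))

  columns : ∀ j → Bijective _≡_ _≡_ (λ r → L2 k r j)
  columns j = mod-map-bijective n (λ r → c2 k r + toℕ j) λ v<n →
    let u , u<n , j+u≡v = +%-surjective n (<⇒≤ (toℕ<n j)) v<n
        r , r<n , c2r≡u = c2-surjective k u<n
    in r , r<n , trans (%-congˡ (trans (cong (_+ toℕ j) c2r≡u) (+-comm u (toℕ j)))) j+u≡v
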